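{- Let $\mathbb{G}$ be a finite graph and let $\mathbb{H}$ be a graph that contains a copy of $\mathbb{K}_3$ (three distinct pairwise adjacent vertices) and whose polymorphism clone $\mathrm{Pol}(\mathbb{H})$ satisfies $\Sigma_{\mathbb{G}}$. Then there is a graph homomorphism from $\mathbb{G}$ to $\mathbb{H}$.
   Context: Graphs are structures $(V,E)$ with $E\subseteq V^2$ symmetric; $\mathbb{K}_3$ is the complete loopless graph on three vertices. A polymorphism of $\mathbb{H}$ is a homomorphism $\mathbb{H}^n\to\mathbb{H}$ where in $\mathbb{H}^n$ two $n$-tuples are adjacent iff they are adjacent in every coordinate; $\mathrm{Pol}(\mathbb{H})$ is the set of all polymorphisms. For a finite graph $\mathbb{G}=(V,E)$, $\Sigma_{\mathbb{G}}$ is the height 1 condition with a ternary symbol $f_v$ for each $v\in V$ and a 6-ary symbol $g_{(u,v)}$ for each $(u,v)\in E$, consisting of the identities $f_u(x,y,z)\approx g_{(u,v)}(x,y,x,z,y,z)$ and $f_v(x,y,z)\approx g_{(u,v)}(y,x,z,x,z,y)$ for all $(u,v)\in E$; a set of functions satisfies it if the symbols can be interpreted by functions from the set of matching arities so that all identities hold for all values of the variables. -}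

module Defs where

open import Level using (Level; _⊔_; suc)
open import Data.Nat using (ℕ)
open import Data.Fin using (Fin)
open import Data.Product using (Σ; _×_; ∃; ∃-syntax)
open import Relation.Binary.PropositionalEquality using (_≡_; _≢_)
open import Data.Vec using (Vec; []; _∷_; lookup)

-- A graph: a vertex set with a symmetric edge relation E ⊆ V².
-- (Loops are allowed, as in the paper.)
record Graph (a ℓ : Level) : Set (Level.suc (a ⊔ ℓ)) where
  field
    V   : Set a
    E   : V → V → Set ℓ
    sym : ∀ {u v} → E u v → E v u
open Graph public

record FinGraph (ℓ : Level) : Set (Level.suc ℓ) where
  field
    size : ℕ
    E    : Fin size → Fin size → Set ℓ
    sym  : ∀ {u v} → E u v → E v u

toGraph : ∀ {ℓ} → FinGraph ℓ → Graph Level.zero ℓ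
toGraph G = record { V = Fin (FinGraph.size G) ; E = FinGraph.E G ; sym = FinGraph.sym G }

Hom : ∀ {a b ℓ m} → Graph a ℓ → Graph b m → Set (a ⊔ b ⊔ ℓ ⊔ m)
Hom G H = Σ (V G → V H) λ h → ∀ {u v} → E G u v → E H (h u) (h v)

ContainsK3 : ∀ {a ℓ} → Graph a ℓ → Set (a ⊔ ℓ)
ContainsK3 H = ∃[ a ] ∃[ b ] ∃[ c ]
  ((a ≢ b) × (b ≢ c) × (a ≢ c) × E H a b × E H b c × E H a c)

-- n-ary polymorphisms of H: homomorphisms Hⁿ → H, where n-tuples are
-- adjacent iff adjacent in every coordinate.
record Pol {a ℓ} (H : Graph a ℓ) (n : ℕ) : Set (a ⊔ ℓ) where
  field
    fun      : Vec (V H) n → V H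
    preserve : ∀ (xs ys : Vec (V H) n) →
               (∀ i → E H (lookup xs i) (lookup ys i)) →
               E H (fun xs) (fun ys)
open Pol public

-- Pol(H) satisfies Σ_G: interpret each ternary f_v and each 6-ary
-- g_(u,v) ((u,v) ∈ E) by polymorphisms so that all identities hold.
Satisfies-Σ : ∀ {ℓ a m} (G : FinGraph ℓ) (H : Graph a m) → Set (ℓ ⊔ a ⊔ m)
Satisfies-Σ G H =
  Σ (Fin (FinGraph.size G) → Pol H 3) λ f →
  Σ (∀ {u v} → FinGraph.E G u v → Pol H 6) λ g →
  ∀ {u v} (e : FinGraph.E G u v) (x y z : V H) →
    (fun (f u) (x ∷ y ∷ z ∷ []) ≡ fun (g e) (x ∷ y ∷ x ∷ z ∷ y ∷ z ∷ []))
    × (fun (f v) (x ∷ y ∷ z ∷ []) ≡ fun (g e) (y ∷ x ∷ z ∷ x ∷ z ∷ y ∷ []))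

module Submission where

open import Level using (Level)
open import Defs
open import Data.Fin using (Fin; zero; suc)
open import Data.Vec using ([]; _∷_; lookup)
open import Data.Product using (_,_; proj₁; proj₂)
open import Relation.Binary.PropositionalEquality using (subst₂) renaming (sym to ≡-sym)

-- Fix a triangle a, b, c in H and send each vertex v of G to f_v(a, b, c).
-- For an edge (u, v), the identities of Σ_G rewrite f_u(a, b, c) and f_v(a, b, c)
-- as g_(u,v) applied to (a, b, a, c, b, c) and (b, a, c, a, c, b), which are
-- adjacent in every coordinate; as g_(u,v) is a polymorphism, the images are adjacent.

module _ {a ℓ} (H : Graph a ℓ) {x y z : V H}
         (xy : E H x y) (yz : E H y z) (xz : E H x z) where

  triangle-columns-adjacent : ∀ (i : Fin 6) →
    E H (lookup (x ∷ y ∷ x ∷ z ∷ y ∷ z ∷ []) i) (lookup (y ∷ x ∷ z ∷ x ∷ z ∷ y ∷ []) i)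
  triangle-columns-adjacent zero                                = xy
  triangle-columns-adjacent (suc zero)                          = Graph.sym H xy
  triangle-columns-adjacent (suc (suc zero))                    = xz
  triangle-columns-adjacent (suc (suc (suc zero)))              = Graph.sym H xz
  triangle-columns-adjacent (suc (suc (suc (suc zero))))        = yz
  triangle-columns-adjacent (suc (suc (suc (suc (suc zero))))) = Graph.sym H yz

  pol6-triangle-adjacent : (p : Pol H 6) →
    E H (fun p (x ∷ y ∷ x ∷ z ∷ y ∷ z ∷ [])) (fun p (y ∷ x ∷ z ∷ x ∷ z ∷ y ∷ []))
  pol6-triangle-adjacent p = preserve p _ _ triangle-columns-adjacent

lemma3p2 : ∀ {ℓ a m : Level} (G : FinGraph ℓ) (H : Graph a m) →
    ContainsK3 H → Satisfies-Σ G H → Hom (toGraph G) H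
lemma3p2 G H (a , b , c , _ , _ , _ , ab , bc , ac) (f , g , identities) =
  (λ v → fun (f v) (a ∷ b ∷ c ∷ [])) , edge-preserved
  where
  edge-preserved : ∀ {u v} → FinGraph.E G u v →
    E H (fun (f u) (a ∷ b ∷ c ∷ [])) (fun (f v) (a ∷ b ∷ c ∷ []))
  edge-preserved e =
    subst₂ (E H) (≡-sym (proj₁ (identities e a b c))) (≡-sym (proj₂ (identities e a b c)))
      (pol6-triangle-adjacent H ab bc ac (g e))
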